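{- Let $G=(V,E)$ be a connected finite simple graph with $|V|\geq 3$ whose minimum degree is at least $|V|/2$. Then $G$ is all-round, or bipartite all-round if $G$ is bipartite.
   Context: For a graph $G=(V,E)$ and $f\colon V\to\{0,1,2,3\}$, a connected mod-4 $f$-factor is a vector $\mathbf{x}\in\{0,1,2,3\}^E$ with $\sum_{e\in\delta(v)}x_e\equiv f(v)\pmod 4$ for all $v\in V$ ($\delta(v)$ = edges incident to $v$) such that the graph $(V,\{e\in E\mid x_e>0\})$ is connected. $G$ is all-round if it has a connected mod-4 $f$-factor for every $f\colon V\to\{0,1,2,3\}$ with $\sum_{v\in V}f(v)$ even. A bipartite $G$ with bipartition classes $U,W$ is bipartite all-round if it has a connected mod-4 $f$-factor for every $f$ with $\sum_{v\in U}f(v)\equiv\sum_{v\in W}f(v)\pmod 4$. -}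

module Defs where

open import Data.Nat using (ℕ; zero; suc; _+_; _*_; _≤_; _%_)
open import Data.Nat.Divisibility using (_∣_)
open import Data.Fin using (Fin; toℕ)
open import Data.Bool using (Bool; true; false; if_then_else_)
open import Data.List using (List; map; allFin)
open import Data.Nat.ListAction using (sum)
open import Data.Product using (_×_; Σ)
open import Relation.Binary.PropositionalEquality using (_≡_; _≢_)
open import Relation.Nullary using (¬_)

Σᵥ : {n : ℕ} → (Fin n → ℕ) → ℕ
Σᵥ {n} g = sum (map g (allFin n))

record SimpleGraph (n : ℕ) : Set where
  field
    Adj   : Fin n → Fin n → Bool
    sym   : ∀ i j → Adj i j ≡ Adj j i
    irref : ∀ i → Adj i i ≡ false
open SimpleGraph public

degree : {n : ℕ} → SimpleGraph n → Fin n → ℕ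
degree G v = Σᵥ (λ w → if Adj G v w then 1 else 0)

data Reach {n : ℕ} (R : Fin n → Fin n → Set) : Fin n → Fin n → Set where
  here : ∀ {i} → Reach R i i
  step : ∀ {i j k} → R i j → Reach R j k → Reach R i k

Connected : {n : ℕ} → (Fin n → Fin n → Set) → Set
Connected {n} R = ∀ (i j : Fin n) → Reach R i j

EdgeRel : {n : ℕ} → SimpleGraph n → Fin n → Fin n → Set
EdgeRel G i j = Adj G i j ≡ true

ConnectedGraph : {n : ℕ} → SimpleGraph n → Set
ConnectedGraph G = Connected (EdgeRel G)

-- A vector x ∈ {0,1,2,3}^E, encoded as a symmetric function on vertex pairs
-- which vanishes on non-edges; x i j is the value on edge {i,j}.
record EdgeVector {n : ℕ} (G : SimpleGraph n) : Set where
  field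
    val     : Fin n → Fin n → Fin 4
    val-sym : ∀ i j → val i j ≡ val j i
    val-off : ∀ i j → Adj G i j ≡ false → toℕ (val i j) ≡ 0
open EdgeVector public

δsum : {n : ℕ} {G : SimpleGraph n} → EdgeVector G → Fin n → ℕ
δsum x v = Σᵥ (λ w → toℕ (val x v w))

IsConnMod4Factor : {n : ℕ} (G : SimpleGraph n) → (Fin n → Fin 4) → EdgeVector G → Set
IsConnMod4Factor {n} G f x =
  (∀ v → δsum x v % 4 ≡ toℕ (f v))
  × Connected (λ i j → toℕ (val x i j) ≢ 0)

HasConnMod4Factor : {n : ℕ} (G : SimpleGraph n) → (Fin n → Fin 4) → Set
HasConnMod4Factor G f = Σ (EdgeVector G) (IsConnMod4Factor G f)

AllRound : {n : ℕ} → SimpleGraph n → Set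
AllRound {n} G = ∀ (f : Fin n → Fin 4) → 2 ∣ Σᵥ (λ v → toℕ (f v)) → HasConnMod4Factor G f

-- proper 2-colouring c : U = c⁻¹(true), W = c⁻¹(false)
IsBipartition : {n : ℕ} → SimpleGraph n → (Fin n → Bool) → Set
IsBipartition G c = ∀ i j → Adj G i j ≡ true → c i ≢ c j

Bipartite : {n : ℕ} → SimpleGraph n → Set
Bipartite {n} G = Σ (Fin n → Bool) (IsBipartition G)

BipAllRound : {n : ℕ} → SimpleGraph n → (Fin n → Bool) → Set
BipAllRound {n} G c = ∀ (f : Fin n → Fin 4) →
  Σᵥ (λ v → if c v then toℕ (f v) else 0) % 4 ≡ Σᵥ (λ v → if c v then 0 else toℕ (f v)) % 4 →
  HasConnMod4Factor G f

-- Fix vertex charges ρ with ρ a + ρ b ≡ 0 (mod 4) on every edge, and call a vertex set S solvable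
-- (rooted at r) if every target f on S whose ρ-weighted sum over S vanishes mod 4 is met by edge
-- weights inside S whose nonzero edges connect S to r. Solvability passes from S to S plus an ear, a
-- path through new vertices with both ends in S: weights on the ear meet f at the new vertices, and
-- the old vertices are solved for f minus the ear's load, whose charge vanishes by the handshake
-- lemma. Under minimum degree n/2 two distinct non-adjacent vertices have a common neighbour other
-- than any prescribed vertex, so while S ≠ V an ear with at most two inner vertices exists. The
-- start is a triangle with ρ = 2 if G is not bipartite (a triangle-free such graph is bipartite),
-- and a 4-cycle with ρ = 1 and 3 on the two sides if it is; the total charge conditions then read
-- 2 ∣ Σ f and Σ_U f ≡ Σ_W f (mod 4).

module Submission where

open import Defs renaming (sym to Adj-sym)
open import Data.Nat using (ℕ; zero; suc; _+_; _*_; _≤_; _<_; _%_; z≤n; s≤s)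
open import Data.Nat.Properties
open import Data.Nat.DivMod using (_mod_; m<n⇒m%n≡m; %-distribˡ-+; %-distribˡ-*; m%n%n≡m%n; [m+kn]%n≡m%n)
open import Data.Nat.Divisibility using (divides)
import Data.Nat.ListAction as List
open import Data.Nat.Tactic.RingSolver using (solve-∀)
open import Algebra.Properties.Semiring.Sum +-*-semiring
  using (sum; sum-cong-≗; ∑-distrib-+; *-distribˡ-sum; sum-replicate-zero)
open import Data.Bool using (Bool; true; false; if_then_else_)
import Data.Bool.Properties as Bool
open import Data.Fin using (Fin; zero; suc; toℕ; fromℕ<)
import Data.Fin.Properties as Fin
open import Data.List using (List; []; _∷_; map; tabulate)
open import Data.List.Properties using (map-tabulate)
open import Data.List.Relation.Unary.All using (All; []; _∷_)
import Data.List.Relation.Unary.All as All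
open import Data.List.Relation.Unary.Any using (here; there)
open import Data.List.Relation.Unary.Unique.Propositional using (Unique)
open import Data.List.Relation.Unary.AllPairs using ([]; _∷_)
open import Data.Fin.Subset using (Subset; _∈_; _∉_; _∪_; ⁅_⁆; _⊆_; _⊂_; _⊃_; ∁; ∣_∣) renaming (⊥ to ∅)
open import Data.Fin.Subset.Properties
  using (_∈?_; x∈p∪q⁻; x∈p∪q⁺; x∈⁅x⁆; x∈⁅y⁆⇒x≡y; p⊆p∪q; ∉⊥; p⊂q⇒∣p∣<∣q∣; p⊂q⇒∁p⊃∁q; x∈∁p⇒x∉p; x∉∁p⇒x∈p; nonempty?)
open import Induction.WellFounded using (WellFounded; Acc; acc; module Subrelation)
import Relation.Binary.Construct.On as On
open import Data.Nat.Induction using (<-wellFounded)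
open import Data.Product using (Σ-syntax; _×_; _,_; proj₁; proj₂)
open import Data.Sum using (_⊎_; inj₁; inj₂; swap)
open import Function using (id; _∘_)
open import Relation.Binary using (Decidable; IsEquivalence; Setoid)
open import Relation.Binary.PropositionalEquality
import Relation.Binary.Reasoning.Setoid
open import Relation.Nullary using (¬_; Dec; yes; no; does; contradiction)
open import Relation.Nullary.Decidable using (map′; dec-true; dec-false; toWitness; ¬?; _×-dec_; _⊎-dec_; _→-dec_)

private variable
  n : ℕ
  a a′ b b′ : ℕ

-- A record, so that both sides can be inferred from a proof.
infix 4 _≡₄_
record _≡₄_ (a b : ℕ) : Set where
  constructor mod4
  field residues : a % 4 ≡ b % 4
open _≡₄_ public

≡⇒≡₄ : a ≡ b → a ≡₄ b
≡⇒≡₄ a≡b = mod4 (cong (_% 4) a≡b)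

≡₄-isEquivalence : IsEquivalence _≡₄_
≡₄-isEquivalence = record
  { refl  = mod4 refl
  ; sym   = λ (mod4 p) → mod4 (sym p)
  ; trans = λ (mod4 p) (mod4 q) → mod4 (trans p q)
  }

≡₄-setoid : Setoid _ _
≡₄-setoid = record { isEquivalence = ≡₄-isEquivalence }

open IsEquivalence ≡₄-isEquivalence public
  using () renaming (refl to ≡₄-refl; sym to ≡₄-sym; trans to ≡₄-trans)

module ≡₄-Reasoning = Relation.Binary.Reasoning.Setoid ≡₄-setoid

+-cong-≡₄ : a ≡₄ a′ → b ≡₄ b′ → a + b ≡₄ a′ + b′
+-cong-≡₄ {a} {a′} {b} {b′} (mod4 p) (mod4 q) = mod4 (begin
  (a + b) % 4             ≡⟨ %-distribˡ-+ a b 4 ⟩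
  (a % 4 + b % 4) % 4     ≡⟨ cong₂ (λ x y → (x + y) % 4) p q ⟩
  (a′ % 4 + b′ % 4) % 4   ≡⟨ %-distribˡ-+ a′ b′ 4 ⟨
  (a′ + b′) % 4           ∎)
  where open ≡-Reasoning

*-congˡ-≡₄ : ∀ k → a ≡₄ a′ → k * a ≡₄ k * a′
*-congˡ-≡₄ {a} {a′} k (mod4 p) = mod4 (begin
  (k * a) % 4             ≡⟨ %-distribˡ-* k a 4 ⟩
  (k % 4 * (a % 4)) % 4   ≡⟨ cong (λ x → (k % 4 * x) % 4) p ⟩
  (k % 4 * (a′ % 4)) % 4  ≡⟨ %-distribˡ-* k a′ 4 ⟨
  (k * a′) % 4            ∎)
  where open ≡-Reasoning

%-≡₄ : ∀ a → a % 4 ≡₄ a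
%-≡₄ a = mod4 (m%n%n≡m%n a 4)

+-4*-≡₄ : ∀ a k → a + 4 * k ≡₄ a
+-4*-≡₄ a k = mod4 (trans (cong (λ x → (a + x) % 4) (*-comm 4 k)) ([m+kn]%n≡m%n a k 4))

≢₄0⇒≢0 : ¬ (a ≡₄ 0) → a ≢ 0
≢₄0⇒≢0 a≢₄0 a≡0 = a≢₄0 (≡⇒≡₄ a≡0)

infix 4 _≡₄?_
_≡₄?_ : Decidable _≡₄_
a ≡₄? b = map′ mod4 residues (a % 4 ≟ b % 4)

Σᵥ≡sum : (g : Fin n → ℕ) → Σᵥ g ≡ sum g
Σᵥ≡sum g = trans (cong List.sum (map-tabulate id g)) (sum-tabulate g)
  where
  sum-tabulate : ∀ {m} (h : Fin m → ℕ) → List.sum (tabulate h) ≡ sum h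
  sum-tabulate {zero}  h = refl
  sum-tabulate {suc m} h = cong (h zero +_) (sum-tabulate (h ∘ suc))

sum-cong-≡₄ : {g h : Fin n → ℕ} → (∀ i → g i ≡₄ h i) → sum g ≡₄ sum h
sum-cong-≡₄ {zero}  g≡h = ≡₄-refl
sum-cong-≡₄ {suc n} g≡h = +-cong-≡₄ (g≡h zero) (sum-cong-≡₄ (g≡h ∘ suc))

sum-one : (n : ℕ) → sum {n} (λ _ → 1) ≡ n
sum-one zero    = refl
sum-one (suc n) = cong suc (sum-one n)

sum-mono-≤ : {g h : Fin n → ℕ} → (∀ i → g i ≤ h i) → sum g ≤ sum h
sum-mono-≤ {zero}  g≤h = z≤n
sum-mono-≤ {suc n} g≤h = +-mono-≤ (g≤h zero) (sum-mono-≤ (g≤h ∘ suc))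

point : Fin n → ℕ → Fin n → ℕ
point a c v = if does (v Fin.≟ a) then c else 0

point-≡ : (a : Fin n) (c : ℕ) → point a c a ≡ c
point-≡ a c rewrite dec-true (a Fin.≟ a) refl = refl

point-≢ : {a v : Fin n} (c : ℕ) → v ≢ a → point a c v ≡ 0
point-≢ {a = a} {v} c v≢a rewrite dec-false (v Fin.≟ a) v≢a = refl

sum-point : (a : Fin n) (c : ℕ) → sum (point a c) ≡ c
sum-point {suc n} zero    c = trans (cong (c +_) (sum-replicate-zero n)) (+-identityʳ c)
sum-point {suc n} (suc a) c = sum-point a c

restrict : Subset n → (Fin n → ℕ) → Fin n → ℕ
restrict S g v = if does (v ∈? S) then g v else 0

restrict-∈ : {S : Subset n} {v : Fin n} (g : Fin n → ℕ) → v ∈ S → restrict S g v ≡ g v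
restrict-∈ {S = S} {v} g v∈S rewrite dec-true (v ∈? S) v∈S = refl

sum-restrict-∅ : (g : Fin n → ℕ) → sum (restrict ∅ g) ≡ 0
sum-restrict-∅ {n} g = trans (sum-cong-≗ outside) (sum-replicate-zero n)
  where
  outside : ∀ v → restrict ∅ g v ≡ 0
  outside v rewrite dec-false (v ∈? ∅) ∉⊥ = refl

∉-∪⁅⁆ : {S : Subset n} {x v : Fin n} → x ∉ S → x ≢ v → x ∉ S ∪ ⁅ v ⁆
∉-∪⁅⁆ {S = S} {v = v} x∉S x≢v x∈ with x∈p∪q⁻ S ⁅ v ⁆ x∈
... | inj₁ x∈S  = x∉S x∈S
... | inj₂ x∈⁅v⁆ = x≢v (x∈⁅y⁆⇒x≡y v x∈⁅v⁆)

sum-restrict-∪⁅⁆ : {S : Subset n} {v : Fin n} (g : Fin n → ℕ) → v ∉ S →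
                   sum (restrict (S ∪ ⁅ v ⁆) g) ≡ sum (restrict S g) + g v
sum-restrict-∪⁅⁆ {S = S} {v} g v∉S = begin
  sum (restrict (S ∪ ⁅ v ⁆) g)                       ≡⟨ sum-cong-≗ split ⟩
  sum (λ x → restrict S g x + point v (g v) x)        ≡⟨ ∑-distrib-+ (restrict S g) (point v (g v)) ⟩
  sum (restrict S g) + sum (point v (g v))            ≡⟨ cong (sum (restrict S g) +_) (sum-point v (g v)) ⟩
  sum (restrict S g) + g v                            ∎
  where
  open ≡-Reasoning
  split : ∀ x → restrict (S ∪ ⁅ v ⁆) g x ≡ restrict S g x + point v (g v) x
  split x with x ∈? S ∪ ⁅ v ⁆ | x ∈? S | x Fin.≟ v
  ... | _     | yes x∈S | yes refl = contradiction x∈S v∉S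
  ... | no x∉ | _       | yes refl = contradiction (x∈p∪q⁺ (inj₂ (x∈⁅x⁆ x))) x∉
  ... | yes _ | no _    | yes refl = refl
  ... | yes _ | yes _   | no _     = sym (+-identityʳ (g x))
  ... | yes x∈ | no x∉S | no x≢v   = contradiction x∈ (∉-∪⁅⁆ x∉S x≢v)
  ... | no x∉ | yes x∈S | no _     = contradiction (p⊆p∪q ⁅ v ⁆ x∈S) x∉
  ... | no _  | no _    | no _     = refl

_∪ₗ_ : Subset n → List (Fin n) → Subset n
S ∪ₗ []       = S
S ∪ₗ (v ∷ vs) = (S ∪ ⁅ v ⁆) ∪ₗ vs

⊆-∪ₗ : (S : Subset n) (vs : List (Fin n)) → S ⊆ S ∪ₗ vs
⊆-∪ₗ S []       x∈S = x∈S
⊆-∪ₗ S (v ∷ vs) x∈S = ⊆-∪ₗ (S ∪ ⁅ v ⁆) vs (p⊆p∪q ⁅ v ⁆ x∈S)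

∪ₗ-covers : (S : Subset n) (vs : List (Fin n)) → All (_∈ S ∪ₗ vs) vs
∪ₗ-covers S []       = []
∪ₗ-covers S (v ∷ vs) = ⊆-∪ₗ (S ∪ ⁅ v ⁆) vs (x∈p∪q⁺ (inj₂ (x∈⁅x⁆ v))) ∷ ∪ₗ-covers (S ∪ ⁅ v ⁆) vs

∪ₗ-new : {P : Fin n → Set} (S : Subset n) (vs : List (Fin n)) {x : Fin n} →
         All P vs → x ∈ S ∪ₗ vs → x ∉ S → P x
∪ₗ-new S []       []         x∈S x∉S = contradiction x∈S x∉S
∪ₗ-new S (v ∷ vs) {x} (pv ∷ pvs) x∈ x∉S with x ∈? S ∪ ⁅ v ⁆
... | no x∉  = ∪ₗ-new (S ∪ ⁅ v ⁆) vs pvs x∈ x∉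
... | yes x∈′ with x∈p∪q⁻ S ⁅ v ⁆ x∈′
...   | inj₁ x∈S   = contradiction x∈S x∉S
...   | inj₂ x∈⁅v⁆ rewrite x∈⁅y⁆⇒x≡y v x∈⁅v⁆ = pv

sum-restrict-∪ₗ : {S : Subset n} {vs : List (Fin n)} (g : Fin n → ℕ) → Unique vs → All (_∉ S) vs →
                  sum (restrict (S ∪ₗ vs) g) ≡ sum (restrict S g) + List.sum (map g vs)
sum-restrict-∪ₗ {S = S} {[]}     g []             []          = sym (+-identityʳ _)
sum-restrict-∪ₗ {S = S} {v ∷ vs} g (v≢vs ∷ uniq) (v∉S ∷ vs∉S) = begin
  sum (restrict ((S ∪ ⁅ v ⁆) ∪ₗ vs) g)
    ≡⟨ sum-restrict-∪ₗ g uniq vs∉S∪v ⟩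
  sum (restrict (S ∪ ⁅ v ⁆) g) + List.sum (map g vs)
    ≡⟨ cong (_+ List.sum (map g vs)) (sum-restrict-∪⁅⁆ g v∉S) ⟩
  sum (restrict S g) + g v + List.sum (map g vs)
    ≡⟨ +-assoc (sum (restrict S g)) (g v) _ ⟩
  sum (restrict S g) + (g v + List.sum (map g vs)) ∎
  where
  open ≡-Reasoning
  vs∉S∪v : All (_∉ S ∪ ⁅ v ⁆) vs
  vs∉S∪v = All.zipWith (λ (x∉S , v≢x) → ∉-∪⁅⁆ x∉S (v≢x ∘ sym)) (vs∉S , v≢vs)

⊃-wellFounded : WellFounded (_⊃_ {n})
⊃-wellFounded = Subrelation.wellFounded (λ S⊂S′ → p⊂q⇒∣p∣<∣q∣ (p⊂q⇒∁p⊃∁q S⊂S′))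
                                        (On.wellFounded (∣_∣ ∘ ∁) <-wellFounded)

∈∉⇒≢ : {S : Subset n} {x y : Fin n} → x ∈ S → y ∉ S → y ≢ x
∈∉⇒≢ x∈S y∉S refl = y∉S x∈S

Reach-map : {R Q : Fin n → Fin n → Set} → (∀ {i j} → R i j → Q i j) → ∀ {i j} → Reach R i j → Reach Q i j
Reach-map R⇒Q here         = here
Reach-map R⇒Q (step r rs) = step (R⇒Q r) (Reach-map R⇒Q rs)

Reach-++ : {R : Fin n → Fin n → Set} {i j k : Fin n} → Reach R i j → Reach R j k → Reach R i k
Reach-++ here         qs = qs
Reach-++ (step r rs) qs = step r (Reach-++ rs qs)

Reach-reverse : {R : Fin n → Fin n → Set} → (∀ {i j} → R i j → R j i) → ∀ {i j} → Reach R i j → Reach R j i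
Reach-reverse R-sym here         = here
Reach-reverse R-sym (step r rs) = Reach-++ (Reach-reverse R-sym rs) (step (R-sym r) here)

Weights : ℕ → Set
Weights n = Fin n → Fin n → ℕ

Support : Weights n → Fin n → Fin n → Set
Support X i j = ¬ (X i j ≡₄ 0)

WeightedEdge : ℕ → Set
WeightedEdge n = Fin n × Fin n × ℕ

edgeWeight : WeightedEdge n → Weights n
edgeWeight (a , b , c) i j = point a (point b c j) i + point b (point a c j) i

weight : List (WeightedEdge n) → Weights n
weight []       i j = 0
weight (e ∷ es) i j = edgeWeight e i j + weight es i j

load : List (WeightedEdge n) → Fin n → ℕ
load []                  v = 0
load ((a , b , c) ∷ es) v = point a c v + point b c v + load es v

point-swap : (a b : Fin n) (c : ℕ) (i j : Fin n) → point a (point b c j) i ≡ point b (point a c i) j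
point-swap a b c i j with i Fin.≟ a | j Fin.≟ b
... | yes _ | yes _ = refl
... | yes _ | no _  = refl
... | no _  | yes _ = refl
... | no _  | no _  = refl

edgeWeight-sym : (e : WeightedEdge n) (i j : Fin n) → edgeWeight e i j ≡ edgeWeight e j i
edgeWeight-sym (a , b , c) i j = trans (cong₂ _+_ (point-swap a b c i j) (point-swap b a c i j))
                                       (+-comm (point b (point a c i) j) (point a (point b c i) j))

weight-sym : (es : List (WeightedEdge n)) (i j : Fin n) → weight es i j ≡ weight es j i
weight-sym []       i j = refl
weight-sym (e ∷ es) i j = cong₂ _+_ (edgeWeight-sym e i j) (weight-sym es i j)

edgeWeight-on : {a b : Fin n} (c : ℕ) → a ≢ b → edgeWeight (a , b , c) a b ≡ c
edgeWeight-on {a = a} {b} c a≢b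
  rewrite point-≡ a (point b c b) | point-≡ b c | point-≢ (point a c b) a≢b = +-identityʳ c

edgeWeight-on′ : {a b : Fin n} (c : ℕ) → a ≢ b → edgeWeight (a , b , c) b a ≡ c
edgeWeight-on′ {a = a} {b} c a≢b = trans (edgeWeight-sym (a , b , c) b a) (edgeWeight-on c a≢b)

pointed-pair-off : {a b i j : Fin n} (c : ℕ) → ¬ (i ≡ a × j ≡ b) → point a (point b c j) i ≡ 0
pointed-pair-off {a = a} {b} {i} {j} c ¬ab with i Fin.≟ a | j Fin.≟ b
... | yes i≡a | yes j≡b = contradiction (i≡a , j≡b) ¬ab
... | yes _   | no _    = refl
... | no _    | _       = refl

edgeWeight-off : {a b i j : Fin n} (c : ℕ) → ¬ (i ≡ a × j ≡ b) → ¬ (i ≡ b × j ≡ a) →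
                 edgeWeight (a , b , c) i j ≡ 0
edgeWeight-off c ¬ab ¬ba = cong₂ _+_ (pointed-pair-off c ¬ab) (pointed-pair-off c ¬ba)

edgeWeight-offˡ : {a b i : Fin n} (c : ℕ) (j : Fin n) → i ≢ a → i ≢ b → edgeWeight (a , b , c) i j ≡ 0
edgeWeight-offˡ {i = i} c j i≢a i≢b = edgeWeight-off {i = i} {j} c (i≢a ∘ proj₁) (i≢b ∘ proj₁)

edgeWeight-offʳ : {a b j : Fin n} (c : ℕ) (i : Fin n) → j ≢ a → j ≢ b → edgeWeight (a , b , c) i j ≡ 0
edgeWeight-offʳ {j = j} c i j≢a j≢b = edgeWeight-off {i = i} {j} c (j≢b ∘ proj₂) (j≢a ∘ proj₂)

weight-vanishes : (Q : Fin n → Fin n → Set) (es : List (WeightedEdge n)) →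
                  All (λ (a , b , _) → Q a b × Q b a) es → ∀ {i j} → ¬ Q i j → weight es i j ≡ 0
weight-vanishes Q []                  []                   ¬Q = refl
weight-vanishes Q ((a , b , c) ∷ es) ((Qab , Qba) ∷ Qes) {i} {j} ¬Q =
  cong₂ _+_ (edgeWeight-off {a = a} {b} {i} {j} c (λ { (refl , refl) → ¬Q Qab }) (λ { (refl , refl) → ¬Q Qba }))
            (weight-vanishes Q es Qes ¬Q)

sum-point-outer : (a v : Fin n) (h : Fin n → ℕ) → sum (λ j → point a (h j) v) ≡ point a (sum h) v
sum-point-outer {n} a v h with v Fin.≟ a
... | yes _ = refl
... | no _  = sum-replicate-zero n

sum-weight : (es : List (WeightedEdge n)) (v : Fin n) → sum (weight es v) ≡ load es v
sum-weight {n} []                  v = sum-replicate-zero n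
sum-weight     ((a , b , c) ∷ es) v = begin
  sum (λ j → edgeWeight (a , b , c) v j + weight es v j)
    ≡⟨ ∑-distrib-+ (edgeWeight (a , b , c) v) (weight es v) ⟩
  sum (edgeWeight (a , b , c) v) + sum (weight es v)
    ≡⟨ cong₂ _+_ (∑-distrib-+ (λ j → point a (point b c j) v) (λ j → point b (point a c j) v)) (sum-weight es v) ⟩
  sum (λ j → point a (point b c j) v) + sum (λ j → point b (point a c j) v) + load es v
    ≡⟨ cong (_+ load es v) (cong₂ _+_ (outer a b) (outer b a)) ⟩
  point a c v + point b c v + load es v ∎
  where
  open ≡-Reasoning
  outer : ∀ x y → sum (λ j → point x (point y c j) v) ≡ point x c v
  outer x y = trans (sum-point-outer x v (point y c)) (cong (λ s → point x s v) (sum-point y c))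

sum-*-point : (g : Fin n → ℕ) (a : Fin n) (c : ℕ) → sum (λ v → g v * point a c v) ≡ g a * c
sum-*-point g a c = trans (sum-cong-≗ pointwise) (sum-point a (g a * c))
  where
  pointwise : ∀ v → g v * point a c v ≡ point a (g a * c) v
  pointwise v with v Fin.≟ a
  ... | yes refl = refl
  ... | no _     = *-zeroʳ (g v)

edgeCharge : (Fin n → ℕ) → List (WeightedEdge n) → ℕ
edgeCharge g es = List.sum (map (λ (a , b , c) → (g a + g b) * c) es)

sum-*-load : (g : Fin n → ℕ) (es : List (WeightedEdge n)) → sum (λ v → g v * load es v) ≡ edgeCharge g es
sum-*-load {n} g []                  = trans (sum-cong-≗ (λ v → *-zeroʳ (g v))) (sum-replicate-zero n)
sum-*-load     g ((a , b , c) ∷ es) = begin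
  sum (λ v → g v * (point a c v + point b c v + load es v))
    ≡⟨ sum-cong-≗ (λ v → trans (*-distribˡ-+ (g v) _ _) (cong (_+ g v * load es v) (*-distribˡ-+ (g v) _ _))) ⟩
  sum (λ v → g v * point a c v + g v * point b c v + g v * load es v)
    ≡⟨ ∑-distrib-+ (λ v → g v * point a c v + g v * point b c v) (λ v → g v * load es v) ⟩
  sum (λ v → g v * point a c v + g v * point b c v) + sum (λ v → g v * load es v)
    ≡⟨ cong₂ _+_ (∑-distrib-+ (λ v → g v * point a c v) (λ v → g v * point b c v)) (sum-*-load g es) ⟩
  sum (λ v → g v * point a c v) + sum (λ v → g v * point b c v) + edgeCharge g es
    ≡⟨ cong (_+ edgeCharge g es) (cong₂ _+_ (sum-*-point g a c) (sum-*-point g b c)) ⟩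
  g a * c + g b * c + edgeCharge g es
    ≡⟨ cong (_+ edgeCharge g es) (sym (*-distribʳ-+ c (g a) (g b))) ⟩
  (g a + g b) * c + edgeCharge g es ∎
  where open ≡-Reasoning

handshake : (ρ : Fin n → ℕ) (es : List (WeightedEdge n)) →
            All (λ (a , b , _) → ρ a + ρ b ≡₄ 0) es → sum (λ v → ρ v * load es v) ≡₄ 0
handshake ρ es balanced = ≡₄-trans (≡⇒≡₄ (sum-*-load ρ es)) (edges-vanish es balanced)
  where
  edges-vanish : ∀ es → All (λ (a , b , _) → ρ a + ρ b ≡₄ 0) es → edgeCharge ρ es ≡₄ 0
  edges-vanish []                  []       = ≡₄-refl
  edges-vanish ((a , b , c) ∷ es) (ab ∷ bs) = +-cong-≡₄ edge (edges-vanish es bs)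
    where
    edge : (ρ a + ρ b) * c ≡₄ 0
    edge = ≡₄-trans (≡⇒≡₄ (*-comm (ρ a + ρ b) c)) (≡₄-trans (*-congˡ-≡₄ c ab) (≡⇒≡₄ (*-zeroʳ c)))

NonZero₄ : Fin 4 → Set
NonZero₄ c = ¬ (toℕ c ≡₄ 0)

nonZero₄? : (c : Fin 4) → Dec (NonZero₄ c)
nonZero₄? c = ¬? (toℕ c ≡₄? 0)

-- Edge weights in ℤ/4 along a path s₀ v₁ … vₖ s₁ giving prescribed sums at the vᵢ, found by exhaustive
-- search; the edges required to be nonzero join every vᵢ to an end of the path.
opaque
  path₁-weights : (x : Fin 4) → Σ[ c₀ ∈ Fin 4 ] Σ[ c₁ ∈ Fin 4 ] (toℕ c₀ + toℕ c₁ ≡₄ toℕ x) × NonZero₄ c₀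
  path₁-weights = toWitness {a? = Fin.all? λ x → Fin.any? λ c₀ → Fin.any? λ c₁ →
    (toℕ c₀ + toℕ c₁ ≡₄? toℕ x) ×-dec nonZero₄? c₀} _

  path₂-weights : (x y : Fin 4) → Σ[ c₀ ∈ Fin 4 ] Σ[ c₁ ∈ Fin 4 ] Σ[ c₂ ∈ Fin 4 ]
    (toℕ c₀ + toℕ c₁ ≡₄ toℕ x) × (toℕ c₁ + toℕ c₂ ≡₄ toℕ y) × NonZero₄ c₀ × NonZero₄ c₂
  path₂-weights = toWitness {a? = Fin.all? λ x → Fin.all? λ y → Fin.any? λ c₀ → Fin.any? λ c₁ → Fin.any? λ c₂ →
    (toℕ c₀ + toℕ c₁ ≡₄? toℕ x) ×-dec (toℕ c₁ + toℕ c₂ ≡₄? toℕ y) ×-dec nonZero₄? c₀ ×-dec nonZero₄? c₂} _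

  path₃-weights : (x y z : Fin 4) → Σ[ c₀ ∈ Fin 4 ] Σ[ c₁ ∈ Fin 4 ] Σ[ c₂ ∈ Fin 4 ] Σ[ c₃ ∈ Fin 4 ]
    (toℕ c₀ + toℕ c₁ ≡₄ toℕ x) × (toℕ c₁ + toℕ c₂ ≡₄ toℕ y) × (toℕ c₂ + toℕ c₃ ≡₄ toℕ z) ×
    NonZero₄ c₀ × NonZero₄ c₁ × NonZero₄ c₃
  path₃-weights = toWitness {a? = Fin.all? λ x → Fin.all? λ y → Fin.all? λ z →
    Fin.any? λ c₀ → Fin.any? λ c₁ → Fin.any? λ c₂ → Fin.any? λ c₃ →
    (toℕ c₀ + toℕ c₁ ≡₄? toℕ x) ×-dec (toℕ c₁ + toℕ c₂ ≡₄? toℕ y) ×-dec (toℕ c₂ + toℕ c₃ ≡₄? toℕ z) ×-dec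
    nonZero₄? c₀ ×-dec nonZero₄? c₁ ×-dec nonZero₄? c₃} _

  -- On a triangle abc with weights p = ab, q = ac, s = bc, two nonzero edges connect it.
  triangle-weights : (x y z : Fin 4) → 2 * (toℕ x + toℕ y + toℕ z) ≡₄ 0 →
    Σ[ p ∈ Fin 4 ] Σ[ q ∈ Fin 4 ] Σ[ s ∈ Fin 4 ]
    (toℕ p + toℕ q ≡₄ toℕ x) × (toℕ p + toℕ s ≡₄ toℕ y) × (toℕ q + toℕ s ≡₄ toℕ z) ×
    ((NonZero₄ p × NonZero₄ q) ⊎ (NonZero₄ p × NonZero₄ s) ⊎ (NonZero₄ q × NonZero₄ s))
  triangle-weights = toWitness {a? = Fin.all? λ x → Fin.all? λ y → Fin.all? λ z →
    (2 * (toℕ x + toℕ y + toℕ z) ≡₄? 0) →-dec (Fin.any? λ p → Fin.any? λ q → Fin.any? λ s →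
    (toℕ p + toℕ q ≡₄? toℕ x) ×-dec (toℕ p + toℕ s ≡₄? toℕ y) ×-dec (toℕ q + toℕ s ≡₄? toℕ z) ×-dec
    ((nonZero₄? p ×-dec nonZero₄? q) ⊎-dec (nonZero₄? p ×-dec nonZero₄? s) ⊎-dec
     (nonZero₄? q ×-dec nonZero₄? s)))} _

units-cancel : (b : Bool) (x : Fin 4) → (if b then 1 else 3) * toℕ x ≡₄ 0 → 0 ≡₄ toℕ x
units-cancel true  = toWitness {a? = Fin.all? λ x → (1 * toℕ x ≡₄? 0) →-dec (0 ≡₄? toℕ x)} _
units-cancel false = toWitness {a? = Fin.all? λ x → (3 * toℕ x ≡₄? 0) →-dec (0 ≡₄? toℕ x)} _

module Adjacency {n : ℕ} (G : SimpleGraph n) where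

  Adj? : (x y : Fin n) → Dec (Adj G x y ≡ true)
  Adj? x y = Adj G x y Bool.≟ true

  Adj⇒≢ : {x y : Fin n} → Adj G x y ≡ true → x ≢ y
  Adj⇒≢ {x} x~x refl = contradiction (trans (sym (irref G x)) x~x) λ ()

  Adj-flip : {x y : Fin n} → Adj G x y ≡ true → Adj G y x ≡ true
  Adj-flip {x} {y} x~y = trans (Adj-sym G y x) x~y

module Extension {n : ℕ} (G : SimpleGraph n) where

  Balanced : (Fin n → ℕ) → Set
  Balanced ρ = ∀ a b → Adj G a b ≡ true → ρ a + ρ b ≡₄ 0

  charge : (Fin n → ℕ) → Subset n → (Fin n → Fin 4) → ℕ
  charge ρ S f = sum (restrict S (λ v → ρ v * toℕ (f v)))

  record PartialFactor (S : Subset n) (r : Fin n) (f : Fin n → Fin 4) : Set where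
    field
      X        : Weights n
      X-sym    : ∀ i j → X i j ≡ X j i
      X-edges  : ∀ i j → Adj G i j ≡ false → X i j ≡ 0
      X-inside : ∀ i j → i ∉ S → X i j ≡ 0
      X-degree : ∀ v → v ∈ S → sum (X v) ≡₄ toℕ (f v)
      X-rooted : ∀ v → v ∈ S → Reach (Support X) v r

  Solvable : (Fin n → ℕ) → Subset n → Fin n → Set
  Solvable ρ S r = ∀ f → charge ρ S f ≡₄ 0 → PartialFactor S r f

  Attaches : Subset n → Subset n → WeightedEdge n → Set
  Attaches S S′ (a , b , _) = Adj G a b ≡ true × a ∈ S′ × b ∈ S′ × (a ∉ S ⊎ b ∉ S)

  Anchored : Subset n → Fin n → Weights n → Fin n → Set
  Anchored S r Y v = Σ[ s ∈ Fin n ] (s ∈ S ⊎ s ≡ r) × Reach (Support Y) v s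

  record Ear (S : Subset n) (vs : List (Fin n)) (r : Fin n) (f : Fin n → Fin 4) : Set where
    field
      edges    : List (WeightedEdge n)
      attach   : All (Attaches S (S ∪ₗ vs)) edges
      load≡f   : All (λ v → load edges v ≡₄ toℕ (f v)) vs
      anchored : All (Anchored S r (weight edges)) vs

  ∅-solvable : (ρ : Fin n → ℕ) (r : Fin n) → Solvable ρ ∅ r
  ∅-solvable ρ r f _ = record
    { X        = λ _ _ → 0
    ; X-sym    = λ _ _ → refl
    ; X-edges  = λ _ _ _ → refl
    ; X-inside = λ _ _ _ → refl
    ; X-degree = λ _ v∈∅ → contradiction v∈∅ ∉⊥
    ; X-rooted = λ _ v∈∅ → contradiction v∈∅ ∉⊥
    }

  charge-everywhere : (ρ : Fin n → ℕ) {S : Subset n} (f : Fin n → Fin 4) → (∀ v → v ∈ S) →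
                      charge ρ S f ≡ sum (λ v → ρ v * toℕ (f v))
  charge-everywhere ρ f everywhere = sum-cong-≗ λ v → restrict-∈ (λ v → ρ v * toℕ (f v)) (everywhere v)

  connected-factor : {S : Subset n} {r : Fin n} {f : Fin n → Fin 4} →
                     (∀ v → v ∈ S) → PartialFactor S r f → HasConnMod4Factor G f
  connected-factor {f = f} everywhere P = x , degrees , connected
    where
    open PartialFactor P
    toℕ-val : ∀ i j → toℕ (X i j mod 4) ≡ X i j % 4
    toℕ-val i j = Fin.toℕ-fromℕ< _
    x : EdgeVector G
    x = record
      { val     = λ i j → X i j mod 4
      ; val-sym = λ i j → Fin.toℕ-injective
          (trans (toℕ-val i j) (trans (cong (_% 4) (X-sym i j)) (sym (toℕ-val j i))))
      ; val-off = λ i j non-adj → trans (toℕ-val i j) (cong (_% 4) (X-edges i j non-adj))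
      }
    degrees : ∀ v → δsum x v % 4 ≡ toℕ (f v)
    degrees v = trans (residues (begin
      δsum x v                       ≡⟨ Σᵥ≡sum (λ w → toℕ (X v w mod 4)) ⟩
      sum (λ w → toℕ (X v w mod 4))  ≡⟨ sum-cong-≗ (toℕ-val v) ⟩
      sum (λ w → X v w % 4)          ≈⟨ sum-cong-≡₄ (λ w → %-≡₄ (X v w)) ⟩
      sum (X v)                      ≈⟨ X-degree v (everywhere v) ⟩
      toℕ (f v)                      ∎)) (m<n⇒m%n≡m (Fin.toℕ<n (f v)))
      where open ≡₄-Reasoning
    Support⇒val≢0 : ∀ {i j} → Support X i j → toℕ (X i j mod 4) ≢ 0
    Support⇒val≢0 {i} {j} s val≡0 = s (mod4 (trans (sym (toℕ-val i j)) val≡0))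
    Support-sym : ∀ {i j} → Support X i j → Support X j i
    Support-sym {i} {j} s = s ∘ subst (_≡₄ 0) (X-sym j i)
    connected : Connected (λ i j → toℕ (X i j mod 4) ≢ 0)
    connected i j = Reach-map Support⇒val≢0
      (Reach-++ (X-rooted i (everywhere i)) (Reach-reverse Support-sym (X-rooted j (everywhere j))))

  module _ {S : Subset n} {vs : List (Fin n)} {r : Fin n} (f : Fin n → Fin 4) (E : Ear S vs r f) where

    open Ear E

    private
      S′ = S ∪ₗ vs
      L  = load edges

    -- f − load, with −1 written as 3 to stay in ℕ.
    corrected : Fin n → Fin 4
    corrected v = (toℕ (f v) + 3 * L v) mod 4

    toℕ-corrected : ∀ v → toℕ (corrected v) ≡₄ toℕ (f v) + 3 * L v
    toℕ-corrected v = ≡₄-trans (≡⇒≡₄ (Fin.toℕ-fromℕ< _)) (%-≡₄ _)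

    load-outside : ∀ {v} → v ∉ S′ → L v ≡ 0
    load-outside {v} v∉S′ = go edges attach
      where
      go : ∀ es → All (Attaches S S′) es → load es v ≡ 0
      go []                  []                           = refl
      go ((a , b , c) ∷ es) ((_ , a∈ , b∈ , _) ∷ attach′) =
        cong₂ _+_ (cong₂ _+_ (point-≢ {a = a} {v} c λ { refl → v∉S′ a∈ })
                             (point-≢ {a = b} {v} c λ { refl → v∉S′ b∈ }))
                  (go es attach′)

    charge-corrected : (ρ : Fin n → ℕ) → ∀ v → restrict S (λ v → ρ v * toℕ (corrected v)) v ≡₄
                             restrict S′ (λ v → ρ v * toℕ (f v)) v + 3 * (ρ v * L v)
    charge-corrected ρ v with v ∈? S | v ∈? S′
    ... | yes _   | yes _ =
      ≡₄-trans (*-congˡ-≡₄ (ρ v) (toℕ-corrected v)) (≡⇒≡₄ (distribute (ρ v) (toℕ (f v)) (L v)))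
      where
      distribute : ∀ ρ f L → ρ * (f + 3 * L) ≡ ρ * f + 3 * (ρ * L)
      distribute = solve-∀
    ... | yes v∈S | no v∉S′ = contradiction (⊆-∪ₗ S vs v∈S) v∉S′
    ... | no v∉S  | yes v∈S′ = ≡₄-sym (≡₄-trans
          (+-cong-≡₄ (*-congˡ-≡₄ (ρ v) (≡₄-sym (∪ₗ-new S vs load≡f v∈S′ v∉S))) ≡₄-refl)
          (+-4*-≡₄ 0 (ρ v * L v)))
    ... | no _    | no v∉S′ rewrite load-outside v∉S′ | *-zeroʳ (ρ v) = ≡₄-refl

    corrected-cond : (ρ : Fin n → ℕ) → Balanced ρ → charge ρ S′ f ≡₄ 0 → charge ρ S corrected ≡₄ 0
    corrected-cond ρ balanced cond = begin
      charge ρ S corrected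
        ≈⟨ sum-cong-≡₄ (charge-corrected ρ) ⟩
      sum (λ v → restrict S′ (λ v → ρ v * toℕ (f v)) v + 3 * (ρ v * L v))
        ≡⟨ ∑-distrib-+ (restrict S′ (λ v → ρ v * toℕ (f v))) (λ v → 3 * (ρ v * L v)) ⟩
      charge ρ S′ f + sum (λ v → 3 * (ρ v * L v))
        ≡⟨ cong (charge ρ S′ f +_) (sym (*-distribˡ-sum 3 (λ v → ρ v * L v))) ⟩
      charge ρ S′ f + 3 * sum (λ v → ρ v * L v)
        ≈⟨ +-cong-≡₄ cond (*-congˡ-≡₄ 3 (handshake ρ edges (All.map (λ (adj , _) → balanced _ _ adj) attach))) ⟩
      0 ∎
      where open ≡₄-Reasoning

    module _ (P : PartialFactor S r corrected) where
      open PartialFactor P renaming (X to X₀)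

      Y : Weights n
      Y = weight edges

      Z : Weights n
      Z i j = X₀ i j + Y i j

      X₀-row-vanishes : ∀ {v} → v ∉ S → sum (X₀ v) ≡ 0
      X₀-row-vanishes {v} v∉S = trans (sum-cong-≗ (λ j → X-inside v j v∉S)) (sum-replicate-zero n)

      X₀-≢0⇒∈ : ∀ {i j} → X₀ i j ≢ 0 → i ∈ S
      X₀-≢0⇒∈ {i} {j} X₀≢0 with i ∈? S
      ... | yes i∈S = i∈S
      ... | no i∉S  = contradiction (X-inside i j i∉S) X₀≢0

      Y-inside-S : ∀ {i j} → i ∈ S → j ∈ S → Y i j ≡ 0
      Y-inside-S i∈S j∈S = weight-vanishes (λ i j → i ∉ S ⊎ j ∉ S) edges
        (All.map (λ (_ , _ , _ , new) → new , swap new) attach)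
        λ { (inj₁ i∉S) → i∉S i∈S ; (inj₂ j∉S) → j∉S j∈S }

      Support-X₀⇒Z : ∀ {i j} → Support X₀ i j → Support Z i j
      Support-X₀⇒Z {i} {j} s = subst (λ z → ¬ (z ≡₄ 0)) (sym Z≡X₀) s
        where
        X₀≢0 = ≢₄0⇒≢0 s
        Z≡X₀ : Z i j ≡ X₀ i j
        Z≡X₀ = trans (cong (X₀ i j +_) (Y-inside-S (X₀-≢0⇒∈ X₀≢0) (X₀-≢0⇒∈ (X₀≢0 ∘ trans (X-sym i j)))))
                     (+-identityʳ _)

      Support-Y⇒Z : ∀ {i j} → Support Y i j → Support Z i j
      Support-Y⇒Z {i} {j} s with i ∈? S | j ∈? S
      ... | yes i∈S | yes j∈S = contradiction (Y-inside-S i∈S j∈S) (≢₄0⇒≢0 s)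
      ... | no i∉S  | _       = subst (λ z → ¬ (z + Y i j ≡₄ 0)) (sym (X-inside i j i∉S)) s
      ... | yes _   | no j∉S  = subst (λ z → ¬ (z + Y i j ≡₄ 0)) (sym (trans (X-sym i j) (X-inside j i j∉S))) s

      Z-degree : ∀ v → v ∈ S′ → sum (Z v) ≡₄ toℕ (f v)
      Z-degree v v∈S′ rewrite ∑-distrib-+ (X₀ v) (Y v) | sum-weight edges v with v ∈? S
      ... | yes v∈S = begin
        sum (X₀ v) + L v                  ≈⟨ +-cong-≡₄ (≡₄-trans (X-degree v v∈S) (toℕ-corrected v)) ≡₄-refl ⟩
        toℕ (f v) + 3 * L v + L v         ≡⟨ +-assoc (toℕ (f v)) (3 * L v) (L v) ⟩
        toℕ (f v) + (3 * L v + L v)       ≡⟨ cong (toℕ (f v) +_) (+-comm (3 * L v) (L v)) ⟩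
        toℕ (f v) + 4 * L v               ≈⟨ +-4*-≡₄ (toℕ (f v)) (L v) ⟩
        toℕ (f v)                         ∎
        where open ≡₄-Reasoning
      ... | no v∉S = begin
        sum (X₀ v) + L v                  ≡⟨ cong (_+ L v) (X₀-row-vanishes v∉S) ⟩
        L v                               ≈⟨ ∪ₗ-new S vs load≡f v∈S′ v∉S ⟩
        toℕ (f v)                         ∎
        where open ≡₄-Reasoning

      Z-rooted : ∀ v → v ∈ S′ → Reach (Support Z) v r
      Z-rooted v v∈S′ with v ∈? S
      ... | yes v∈S = Reach-map Support-X₀⇒Z (X-rooted v v∈S)
      ... | no v∉S with ∪ₗ-new S vs anchored v∈S′ v∉S
      ...   | s , inj₁ s∈S , v⇝s = Reach-++ (Reach-map Support-Y⇒Z v⇝s) (Reach-map Support-X₀⇒Z (X-rooted s s∈S))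
      ...   | s , inj₂ refl , v⇝r = Reach-map Support-Y⇒Z v⇝r

      extended : PartialFactor S′ r f
      extended = record
        { X        = Z
        ; X-sym    = λ i j → cong₂ _+_ (X-sym i j) (weight-sym edges i j)
        ; X-edges  = λ i j non-adj → cong₂ _+_ (X-edges i j non-adj)
            (weight-vanishes (λ i j → Adj G i j ≡ true) edges
               (All.map (λ (adj , _) → adj , trans (Adj-sym G _ _) adj) attach)
               λ adj → contradiction (trans (sym non-adj) adj) λ ())
        ; X-inside = λ i j i∉S′ → cong₂ _+_ (X-inside i j (i∉S′ ∘ ⊆-∪ₗ S vs))
            (weight-vanishes (λ i j → i ∈ S′) edges (All.map (λ (_ , a∈ , b∈ , _) → a∈ , b∈) attach) i∉S′)
        ; X-degree = Z-degree
        ; X-rooted = Z-rooted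
        }

  extend : {ρ : Fin n → ℕ} {S : Subset n} {vs : List (Fin n)} {r : Fin n} →
           Balanced ρ → Solvable ρ S r → (∀ f → charge ρ (S ∪ₗ vs) f ≡₄ 0 → Ear S vs r f) →
           Solvable ρ (S ∪ₗ vs) r
  extend {ρ} balanced solvable ear f cond =
    extended f E (solvable (corrected f E) (corrected-cond f E ρ balanced cond))
    where E = ear f cond

module Ears {n : ℕ} (G : SimpleGraph n) where
  open Adjacency G
  open Extension G

  Support-≡ : (X : Weights n) (i j : Fin n) {c : ℕ} → X i j ≡ c → ¬ (c ≡₄ 0) → Support X i j
  Support-≡ X i j X≡c c≢0 = subst (λ x → ¬ (x ≡₄ 0)) (sym X≡c) c≢0

  ear₁ : {S : Subset n} {r s₁ s₂ v : Fin n} → s₁ ∈ S → s₂ ∈ S → s₁ ≢ s₂ → v ∉ S →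
         Adj G v s₁ ≡ true → Adj G v s₂ ≡ true → ∀ f → Ear S (v ∷ []) r f
  ear₁ {S} {r} {s₁} {s₂} {v} s₁∈S s₂∈S s₁≢s₂ v∉S v~s₁ v~s₂ f with path₁-weights (f v)
  ... | c₀ , c₁ , c₀+c₁≡f , c₀≢0 = record
    { edges    = edges
    ; attach   = (Adj-flip v~s₁ , old s₁∈S , v∈S′ , inj₂ v∉S) ∷ (v~s₂ , v∈S′ , old s₂∈S , inj₁ v∉S) ∷ []
    ; load≡f   = ≡₄-trans (≡⇒≡₄ load-v) c₀+c₁≡f ∷ []
    ; anchored = (s₁ , inj₁ s₁∈S , step (Support-≡ (weight edges) v s₁ weight-v-s₁ c₀≢0) here) ∷ []
    }
    where
    edges = (s₁ , v , toℕ c₀) ∷ (v , s₂ , toℕ c₁) ∷ []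
    old = ⊆-∪ₗ S (v ∷ [])
    v∈S′ = All.lookup (∪ₗ-covers S (v ∷ [])) (here refl)
    v≢s₁ = ∈∉⇒≢ s₁∈S v∉S
    v≢s₂ = ∈∉⇒≢ s₂∈S v∉S
    load-v : load edges v ≡ toℕ c₀ + toℕ c₁
    load-v rewrite point-≢ (toℕ c₀) v≢s₁ | point-≡ v (toℕ c₀) | point-≡ v (toℕ c₁) | point-≢ (toℕ c₁) v≢s₂
                 | +-identityʳ (toℕ c₁) | +-identityʳ (toℕ c₁) = refl
    weight-v-s₁ : weight edges v s₁ ≡ toℕ c₀
    weight-v-s₁ rewrite edgeWeight-on′ (toℕ c₀) (v≢s₁ ∘ sym)
                      | edgeWeight-offʳ (toℕ c₁) v (v≢s₁ ∘ sym) s₁≢s₂ = +-identityʳ _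

  ear₂ : {S : Subset n} {r s₁ s₂ v₁ v₂ : Fin n} → s₁ ∈ S → s₂ ∈ S → v₁ ∉ S → v₂ ∉ S →
         Adj G v₁ s₁ ≡ true → Adj G v₁ v₂ ≡ true → Adj G v₂ s₂ ≡ true → ∀ f → Ear S (v₁ ∷ v₂ ∷ []) r f
  ear₂ {S} {r} {s₁} {s₂} {v₁} {v₂} s₁∈S s₂∈S v₁∉S v₂∉S v₁~s₁ v₁~v₂ v₂~s₂ f
    with path₂-weights (f v₁) (f v₂)
  ... | c₀ , c₁ , c₂ , c₀+c₁≡f , c₁+c₂≡f , c₀≢0 , c₂≢0 = record
    { edges    = edges
    ; attach   = (Adj-flip v₁~s₁ , old s₁∈S , v₁∈S′ , inj₂ v₁∉S) ∷ (v₁~v₂ , v₁∈S′ , v₂∈S′ , inj₁ v₁∉S)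
               ∷ (v₂~s₂ , v₂∈S′ , old s₂∈S , inj₁ v₂∉S) ∷ []
    ; load≡f   = ≡₄-trans (≡⇒≡₄ load-v₁) c₀+c₁≡f ∷ ≡₄-trans (≡⇒≡₄ load-v₂) c₁+c₂≡f ∷ []
    ; anchored = (s₁ , inj₁ s₁∈S , step (Support-≡ (weight edges) v₁ s₁ weight-v₁-s₁ c₀≢0) here)
               ∷ (s₂ , inj₁ s₂∈S , step (Support-≡ (weight edges) v₂ s₂ weight-v₂-s₂ c₂≢0) here) ∷ []
    }
    where
    edges = (s₁ , v₁ , toℕ c₀) ∷ (v₁ , v₂ , toℕ c₁) ∷ (v₂ , s₂ , toℕ c₂) ∷ []
    old = ⊆-∪ₗ S (v₁ ∷ v₂ ∷ [])
    v₁∈S′ = All.lookup (∪ₗ-covers S (v₁ ∷ v₂ ∷ [])) (here refl)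
    v₂∈S′ = All.lookup (∪ₗ-covers S (v₁ ∷ v₂ ∷ [])) (there (here refl))
    v₁≢s₁ = ∈∉⇒≢ s₁∈S v₁∉S
    v₁≢s₂ = ∈∉⇒≢ s₂∈S v₁∉S
    v₂≢s₁ = ∈∉⇒≢ s₁∈S v₂∉S
    v₂≢s₂ = ∈∉⇒≢ s₂∈S v₂∉S
    v₁≢v₂ = Adj⇒≢ v₁~v₂
    load-v₁ : load edges v₁ ≡ toℕ c₀ + toℕ c₁
    load-v₁ rewrite point-≢ (toℕ c₀) v₁≢s₁ | point-≡ v₁ (toℕ c₀) | point-≡ v₁ (toℕ c₁) | point-≢ (toℕ c₁) v₁≢v₂
                  | point-≢ (toℕ c₂) v₁≢v₂ | point-≢ (toℕ c₂) v₁≢s₂ | +-identityʳ (toℕ c₁)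
                  | +-identityʳ (toℕ c₁) = refl
    load-v₂ : load edges v₂ ≡ toℕ c₁ + toℕ c₂
    load-v₂ rewrite point-≢ (toℕ c₀) v₂≢s₁ | point-≢ (toℕ c₀) (v₁≢v₂ ∘ sym) | point-≢ (toℕ c₁) (v₁≢v₂ ∘ sym)
                  | point-≡ v₂ (toℕ c₁) | point-≡ v₂ (toℕ c₂) | point-≢ (toℕ c₂) v₂≢s₂
                  | +-identityʳ (toℕ c₂) | +-identityʳ (toℕ c₂) = refl
    weight-v₁-s₁ : weight edges v₁ s₁ ≡ toℕ c₀
    weight-v₁-s₁ rewrite edgeWeight-on′ (toℕ c₀) (v₁≢s₁ ∘ sym)
                       | edgeWeight-offʳ (toℕ c₁) v₁ (v₁≢s₁ ∘ sym) (v₂≢s₁ ∘ sym)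
                       | edgeWeight-offˡ (toℕ c₂) s₁ v₁≢v₂ v₁≢s₂ = +-identityʳ _
    weight-v₂-s₂ : weight edges v₂ s₂ ≡ toℕ c₂
    weight-v₂-s₂ rewrite edgeWeight-offˡ (toℕ c₀) s₂ v₂≢s₁ (v₁≢v₂ ∘ sym)
                       | edgeWeight-offʳ (toℕ c₁) v₂ (v₁≢s₂ ∘ sym) (v₂≢s₂ ∘ sym)
                       | edgeWeight-on (toℕ c₂) v₂≢s₂ = +-identityʳ _

  ear₃ : {S : Subset n} {r s₁ s₂ v₁ v₂ v₃ : Fin n} → s₁ ∈ S → s₂ ∈ S → v₁ ∉ S → v₂ ∉ S → v₃ ∉ S → v₁ ≢ v₃ →
         Adj G v₁ s₁ ≡ true → Adj G v₁ v₂ ≡ true → Adj G v₂ v₃ ≡ true → Adj G v₃ s₂ ≡ true →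
         ∀ f → Ear S (v₁ ∷ v₂ ∷ v₃ ∷ []) r f
  ear₃ {S} {r} {s₁} {s₂} {v₁} {v₂} {v₃} s₁∈S s₂∈S v₁∉S v₂∉S v₃∉S v₁≢v₃ v₁~s₁ v₁~v₂ v₂~v₃ v₃~s₂ f
    with path₃-weights (f v₁) (f v₂) (f v₃)
  ... | c₀ , c₁ , c₂ , c₃ , c₀+c₁≡f , c₁+c₂≡f , c₂+c₃≡f , c₀≢0 , c₁≢0 , c₃≢0 = record
    { edges    = edges
    ; attach   = (Adj-flip v₁~s₁ , old s₁∈S , v₁∈S′ , inj₂ v₁∉S) ∷ (v₁~v₂ , v₁∈S′ , v₂∈S′ , inj₁ v₁∉S)
               ∷ (v₂~v₃ , v₂∈S′ , v₃∈S′ , inj₁ v₂∉S) ∷ (v₃~s₂ , v₃∈S′ , old s₂∈S , inj₁ v₃∉S) ∷ []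
    ; load≡f   = ≡₄-trans (≡⇒≡₄ load-v₁) c₀+c₁≡f ∷ ≡₄-trans (≡⇒≡₄ load-v₂) c₁+c₂≡f
               ∷ ≡₄-trans (≡⇒≡₄ load-v₃) c₂+c₃≡f ∷ []
    ; anchored = (s₁ , inj₁ s₁∈S , v₁⇝s₁)
               ∷ (s₁ , inj₁ s₁∈S , step (Support-≡ (weight edges) v₂ v₁ weight-v₂-v₁ c₁≢0) v₁⇝s₁)
               ∷ (s₂ , inj₁ s₂∈S , step (Support-≡ (weight edges) v₃ s₂ weight-v₃-s₂ c₃≢0) here) ∷ []
    }
    where
    edges = (s₁ , v₁ , toℕ c₀) ∷ (v₁ , v₂ , toℕ c₁) ∷ (v₂ , v₃ , toℕ c₂) ∷ (v₃ , s₂ , toℕ c₃) ∷ []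
    old = ⊆-∪ₗ S (v₁ ∷ v₂ ∷ v₃ ∷ [])
    v₁∈S′ = All.lookup (∪ₗ-covers S (v₁ ∷ v₂ ∷ v₃ ∷ [])) (here refl)
    v₂∈S′ = All.lookup (∪ₗ-covers S (v₁ ∷ v₂ ∷ v₃ ∷ [])) (there (here refl))
    v₃∈S′ = All.lookup (∪ₗ-covers S (v₁ ∷ v₂ ∷ v₃ ∷ [])) (there (there (here refl)))
    v₁≢s₁ = ∈∉⇒≢ s₁∈S v₁∉S
    v₁≢s₂ = ∈∉⇒≢ s₂∈S v₁∉S
    v₂≢s₁ = ∈∉⇒≢ s₁∈S v₂∉S
    v₂≢s₂ = ∈∉⇒≢ s₂∈S v₂∉S
    v₃≢s₁ = ∈∉⇒≢ s₁∈S v₃∉S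
    v₃≢s₂ = ∈∉⇒≢ s₂∈S v₃∉S
    v₁≢v₂ = Adj⇒≢ v₁~v₂
    v₂≢v₃ = Adj⇒≢ v₂~v₃
    load-v₁ : load edges v₁ ≡ toℕ c₀ + toℕ c₁
    load-v₁ rewrite point-≢ (toℕ c₀) v₁≢s₁ | point-≡ v₁ (toℕ c₀) | point-≡ v₁ (toℕ c₁) | point-≢ (toℕ c₁) v₁≢v₂
                  | point-≢ (toℕ c₂) v₁≢v₂ | point-≢ (toℕ c₂) v₁≢v₃ | point-≢ (toℕ c₃) v₁≢v₃
                  | point-≢ (toℕ c₃) v₁≢s₂
                  | +-identityʳ (toℕ c₁) | +-identityʳ (toℕ c₁) = refl
    load-v₂ : load edges v₂ ≡ toℕ c₁ + toℕ c₂
    load-v₂ rewrite point-≢ (toℕ c₀) v₂≢s₁ | point-≢ (toℕ c₀) (v₁≢v₂ ∘ sym) | point-≢ (toℕ c₁) (v₁≢v₂ ∘ sym)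
                  | point-≡ v₂ (toℕ c₁) | point-≡ v₂ (toℕ c₂) | point-≢ (toℕ c₂) v₂≢v₃
                  | point-≢ (toℕ c₃) v₂≢v₃ | point-≢ (toℕ c₃) v₂≢s₂ | +-identityʳ (toℕ c₂)
                  | +-identityʳ (toℕ c₂) = refl
    load-v₃ : load edges v₃ ≡ toℕ c₂ + toℕ c₃
    load-v₃ rewrite point-≢ (toℕ c₀) v₃≢s₁ | point-≢ (toℕ c₀) (v₁≢v₃ ∘ sym) | point-≢ (toℕ c₁) (v₁≢v₃ ∘ sym)
                  | point-≢ (toℕ c₁) (v₂≢v₃ ∘ sym) | point-≢ (toℕ c₂) (v₂≢v₃ ∘ sym) | point-≡ v₃ (toℕ c₂)
                  | point-≡ v₃ (toℕ c₃) | point-≢ (toℕ c₃) v₃≢s₂ | +-identityʳ (toℕ c₃)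
                  | +-identityʳ (toℕ c₃) = refl
    weight-v₁-s₁ : weight edges v₁ s₁ ≡ toℕ c₀
    weight-v₁-s₁ rewrite edgeWeight-on′ (toℕ c₀) (v₁≢s₁ ∘ sym)
                       | edgeWeight-offʳ (toℕ c₁) v₁ (v₁≢s₁ ∘ sym) (v₂≢s₁ ∘ sym)
                       | edgeWeight-offˡ (toℕ c₂) s₁ v₁≢v₂ v₁≢v₃
                       | edgeWeight-offˡ (toℕ c₃) s₁ v₁≢v₃ v₁≢s₂ = +-identityʳ _
    v₁⇝s₁ : Reach (Support (weight edges)) v₁ s₁
    v₁⇝s₁ = step (Support-≡ (weight edges) v₁ s₁ weight-v₁-s₁ c₀≢0) here
    weight-v₂-v₁ : weight edges v₂ v₁ ≡ toℕ c₁
    weight-v₂-v₁ rewrite edgeWeight-offˡ (toℕ c₀) v₁ v₂≢s₁ (v₁≢v₂ ∘ sym)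
                       | edgeWeight-on′ (toℕ c₁) v₁≢v₂
                       | edgeWeight-offʳ (toℕ c₂) v₂ v₁≢v₂ v₁≢v₃
                       | edgeWeight-offˡ (toℕ c₃) v₁ v₂≢v₃ v₂≢s₂ = +-identityʳ _
    weight-v₃-s₂ : weight edges v₃ s₂ ≡ toℕ c₃
    weight-v₃-s₂ rewrite edgeWeight-offˡ (toℕ c₀) s₂ v₃≢s₁ (v₁≢v₃ ∘ sym)
                       | edgeWeight-offˡ (toℕ c₁) s₂ (v₁≢v₃ ∘ sym) (v₂≢v₃ ∘ sym)
                       | edgeWeight-offʳ (toℕ c₂) v₃ (v₂≢s₂ ∘ sym) (v₃≢s₂ ∘ sym)
                       | edgeWeight-on (toℕ c₃) v₃≢s₂ = +-identityʳ _

  triangle-ear : {a b c : Fin n} → Adj G a b ≡ true → Adj G a c ≡ true → Adj G b c ≡ true →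
                 ∀ f → 2 * (toℕ (f a) + toℕ (f b) + toℕ (f c)) ≡₄ 0 → Ear ∅ (a ∷ b ∷ c ∷ []) a f
  triangle-ear {a} {b} {c} a~b a~c b~c f even with triangle-weights (f a) (f b) (f c) even
  ... | p , q , s , p+q≡f , p+s≡f , q+s≡f , connecting = record
    { edges    = edges
    ; attach   = (a~b , a∈T , b∈T , inj₁ ∉⊥) ∷ (a~c , a∈T , c∈T , inj₁ ∉⊥) ∷ (b~c , b∈T , c∈T , inj₁ ∉⊥) ∷ []
    ; load≡f   = ≡₄-trans (≡⇒≡₄ load-a) p+q≡f ∷ ≡₄-trans (≡⇒≡₄ load-b) p+s≡f ∷ ≡₄-trans (≡⇒≡₄ load-c) q+s≡f ∷ []
    ; anchored = (a , inj₂ refl , here) ∷ (a , inj₂ refl , b⇝a connecting) ∷ (a , inj₂ refl , c⇝a connecting) ∷ []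
    }
    where
    edges = (a , b , toℕ p) ∷ (a , c , toℕ q) ∷ (b , c , toℕ s) ∷ []
    a∈T = All.lookup (∪ₗ-covers ∅ (a ∷ b ∷ c ∷ [])) (here refl)
    b∈T = All.lookup (∪ₗ-covers ∅ (a ∷ b ∷ c ∷ [])) (there (here refl))
    c∈T = All.lookup (∪ₗ-covers ∅ (a ∷ b ∷ c ∷ [])) (there (there (here refl)))
    a≢b = Adj⇒≢ a~b
    a≢c = Adj⇒≢ a~c
    b≢c = Adj⇒≢ b~c
    load-a : load edges a ≡ toℕ p + toℕ q
    load-a rewrite point-≡ a (toℕ p) | point-≢ (toℕ p) a≢b | point-≡ a (toℕ q) | point-≢ (toℕ q) a≢c
                 | point-≢ (toℕ s) a≢b | point-≢ (toℕ s) a≢c | +-identityʳ (toℕ p) | +-identityʳ (toℕ q)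
                 | +-identityʳ (toℕ q) = refl
    load-b : load edges b ≡ toℕ p + toℕ s
    load-b rewrite point-≢ (toℕ p) (a≢b ∘ sym) | point-≡ b (toℕ p) | point-≢ (toℕ q) (a≢b ∘ sym)
                 | point-≢ (toℕ q) b≢c | point-≡ b (toℕ s) | point-≢ (toℕ s) b≢c
                 | +-identityʳ (toℕ s) | +-identityʳ (toℕ s) = refl
    load-c : load edges c ≡ toℕ q + toℕ s
    load-c rewrite point-≢ (toℕ p) (a≢c ∘ sym) | point-≢ (toℕ p) (b≢c ∘ sym) | point-≢ (toℕ q) (a≢c ∘ sym)
                 | point-≡ c (toℕ q) | point-≢ (toℕ s) (b≢c ∘ sym) | point-≡ c (toℕ s)
                 | +-identityʳ (toℕ s) = refl
    weight-b-a : weight edges b a ≡ toℕ p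
    weight-b-a rewrite edgeWeight-on′ (toℕ p) a≢b
                     | edgeWeight-offˡ (toℕ q) a (a≢b ∘ sym) b≢c
                     | edgeWeight-offʳ (toℕ s) b a≢b a≢c = +-identityʳ _
    weight-c-a : weight edges c a ≡ toℕ q
    weight-c-a rewrite edgeWeight-offˡ (toℕ p) a (a≢c ∘ sym) (b≢c ∘ sym)
                     | edgeWeight-on′ (toℕ q) a≢c
                     | edgeWeight-offʳ (toℕ s) c a≢b a≢c = +-identityʳ _
    weight-b-c : weight edges b c ≡ toℕ s
    weight-b-c rewrite edgeWeight-offʳ (toℕ p) b (a≢c ∘ sym) (b≢c ∘ sym)
                     | edgeWeight-offˡ (toℕ q) c (a≢b ∘ sym) b≢c
                     | edgeWeight-on (toℕ s) b≢c = +-identityʳ _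
    weight-c-b : weight edges c b ≡ toℕ s
    weight-c-b = trans (weight-sym edges c b) weight-b-c
    b→a = Support-≡ (weight edges) b a weight-b-a
    c→a = Support-≡ (weight edges) c a weight-c-a
    b→c = Support-≡ (weight edges) b c weight-b-c
    c→b = Support-≡ (weight edges) c b weight-c-b
    b⇝a : (NonZero₄ p × NonZero₄ q) ⊎ (NonZero₄ p × NonZero₄ s) ⊎ (NonZero₄ q × NonZero₄ s) →
          Reach (Support (weight edges)) b a
    b⇝a (inj₁ (p≢0 , _))        = step (b→a p≢0) here
    b⇝a (inj₂ (inj₁ (p≢0 , _))) = step (b→a p≢0) here
    b⇝a (inj₂ (inj₂ (q≢0 , s≢0))) = step {j = c} (b→c s≢0) (step (c→a q≢0) here)
    c⇝a : (NonZero₄ p × NonZero₄ q) ⊎ (NonZero₄ p × NonZero₄ s) ⊎ (NonZero₄ q × NonZero₄ s) →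
          Reach (Support (weight edges)) c a
    c⇝a (inj₁ (_ , q≢0))        = step (c→a q≢0) here
    c⇝a (inj₂ (inj₁ (p≢0 , s≢0))) = step {j = b} (c→b s≢0) (step (b→a p≢0) here)
    c⇝a (inj₂ (inj₂ (q≢0 , _))) = step (c→a q≢0) here

module Dense {n : ℕ} (G : SimpleGraph n) (dense : ∀ v → n ≤ 2 * degree G v) where
  open Adjacency G
  open Extension G
  open Ears G

  adj : Fin n → Fin n → ℕ
  adj x w = if Adj G x w then 1 else 0

  -- Two vertices of degree at least n/2 have together at least n neighbours, so no extra weight e
  -- beyond d fits next to their neighbourhoods.
  dense-sum : ∀ v → n ≤ 2 * sum (adj v)
  dense-sum v = subst (λ d → n ≤ 2 * d) (Σᵥ≡sum (adj v)) (dense v)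

  neighbourhoods-overlap : (x y : Fin n) (e d : Fin n → ℕ) → sum d < sum e →
                           ¬ (∀ w → adj x w + adj y w + e w ≤ 1 + d w)
  neighbourhoods-overlap x y e d sd<se bound = <-irrefl refl (begin-strict
    n + n             ≤⟨ +-mono-≤ (dense-sum x) (dense-sum y) ⟩
    2 * dx + 2 * dy   ≡⟨ sym (*-distribˡ-+ 2 dx dy) ⟩
    2 * (dx + dy)     <⟨ *-monoʳ-< 2 dx+dy<n ⟩
    2 * n             ≡⟨ cong (n +_) (+-identityʳ n) ⟩
    n + n             ∎)
    where
    open ≤-Reasoning
    dx = sum (adj x)
    dy = sum (adj y)
    dx+dy<n : dx + dy < n
    dx+dy<n = +-cancelʳ-< (sum e) (dx + dy) n (begin-strict
      dx + dy + sum e                      ≡⟨ cong (_+ sum e) (∑-distrib-+ (adj x) (adj y)) ⟨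
      sum (λ w → adj x w + adj y w) + sum e ≡⟨ ∑-distrib-+ (λ w → adj x w + adj y w) e ⟨
      sum (λ w → adj x w + adj y w + e w)  ≤⟨ sum-mono-≤ bound ⟩
      sum (λ w → 1 + d w)                  ≡⟨ ∑-distrib-+ {n} (λ _ → 1) d ⟩
      sum {n} (λ _ → 1) + sum d            ≡⟨ cong (_+ sum d) (sum-one n) ⟩
      n + sum d                            <⟨ +-monoʳ-< n sd<se ⟩
      n + sum e                            ∎)

  another-neighbour : 3 ≤ n → (x p : Fin n) → Σ[ w ∈ Fin n ] Adj G x w ≡ true × w ≢ p
  another-neighbour 3≤n x p with Fin.any? (λ w → Adj? x w ×-dec ¬? (w Fin.≟ p))
  ... | yes found = found
  ... | no none   = contradiction (begin
      3               ≤⟨ 3≤n ⟩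
      n               ≤⟨ dense-sum x ⟩
      2 * sum (adj x) ≤⟨ *-monoʳ-≤ 2 (subst (sum (adj x) ≤_) (sum-point p 1) (sum-mono-≤ only-p)) ⟩
      2 * 1           ∎) λ { (s≤s (s≤s ())) }
    where
    open ≤-Reasoning
    only-p : ∀ w → adj x w ≤ point p 1 w
    only-p w with w Fin.≟ p | Adj G x w in x~w
    ... | yes _   | true  = ≤-refl
    ... | no w≢p  | true  = contradiction (w , x~w , w≢p) none
    ... | _       | false = z≤n

  common-neighbour : {y z : Fin n} → y ≢ z → Adj G y z ≡ false → (p : Fin n) →
                     Σ[ c ∈ Fin n ] Adj G y c ≡ true × Adj G z c ≡ true × c ≢ p
  common-neighbour {y} {z} y≢z y≁z p with Fin.any? (λ c → Adj? y c ×-dec Adj? z c ×-dec ¬? (c Fin.≟ p))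
  ... | yes found = found
  ... | no none   =
    contradiction bound (neighbourhoods-overlap y z (λ x → point y 1 x + point z 1 x) (point p 1) 1<2)
    where
    1<2 : sum (point p 1) < sum (λ x → point y 1 x + point z 1 x)
    1<2 = subst₂ _<_ (sym (sum-point p 1))
                     (sym (trans (∑-distrib-+ (point y 1) (point z 1)) (cong₂ _+_ (sum-point y 1) (sum-point z 1))))
                     ≤-refl
    bound : ∀ x → adj y x + adj z x + (point y 1 x + point z 1 x) ≤ 1 + point p 1 x
    bound x with x Fin.≟ y | x Fin.≟ z
    ... | yes refl | yes refl = contradiction refl y≢z
    ... | yes refl | no _ rewrite irref G x | Adj-sym G z x | y≁z = s≤s z≤n
    ... | no _     | yes refl rewrite y≁z | irref G x = s≤s z≤n
    ... | no _     | no _ with Adj G y x in y~x | Adj G z x in z~x | x Fin.≟ p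
    ...   | true  | true  | yes _   = ≤-refl
    ...   | true  | true  | no x≢p  = contradiction (x , y~x , z~x , x≢p) none
    ...   | true  | false | _       = s≤s z≤n
    ...   | false | true  | _       = s≤s z≤n
    ...   | false | false | _       = z≤n

  Triangle : Set
  Triangle = Σ[ a ∈ Fin n ] Σ[ b ∈ Fin n ] Σ[ c ∈ Fin n ] Adj G a b ≡ true × Adj G a c ≡ true × Adj G b c ≡ true

  triangle? : Dec Triangle
  triangle? = Fin.any? λ a → Fin.any? λ b → Fin.any? λ c → Adj? a b ×-dec Adj? a c ×-dec Adj? b c

  -- The neighbourhoods of the ends of an edge uv are disjoint and too large to miss a vertex,
  -- so adjacency to u is a proper 2-colouring.
  triangle-free⇒bipartite : 3 ≤ n → ¬ Triangle → Bipartite G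
  triangle-free⇒bipartite 3≤n no-triangle = (λ w → Adj G u w) , proper
    where
    u : Fin n
    u = fromℕ< (≤-trans (s≤s z≤n) 3≤n)
    v = proj₁ (another-neighbour 3≤n u u)
    u~v = proj₁ (proj₂ (another-neighbour 3≤n u u))
    covered : ∀ w → Adj G u w ≡ false → Adj G v w ≡ true
    covered w u≁w with Adj G v w in v~w
    ... | true  = refl
    ... | false = contradiction bound (neighbourhoods-overlap u v (point w 1) (λ _ → 0) 0<1)
      where
      0<1 : sum {n} (λ _ → 0) < sum (point w 1)
      0<1 = subst₂ _<_ (sym (sum-replicate-zero n)) (sym (sum-point w 1)) ≤-refl
      bound : ∀ x → adj u x + adj v x + point w 1 x ≤ 1 + 0
      bound x with x Fin.≟ w
      ... | yes refl rewrite u≁w | v~w = ≤-refl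
      ... | no _ with Adj G u x in u~x | Adj G v x in v~x
      ...   | true  | true  = contradiction (u , v , x , u~v , u~x , v~x) no-triangle
      ...   | true  | false = ≤-refl
      ...   | false | true  = ≤-refl
      ...   | false | false = z≤n
    proper : IsBipartition G (λ w → Adj G u w)
    proper i j i~j same with Adj G u i in u~i
    ... | true  = no-triangle (u , i , j , u~i , sym same , i~j)
    ... | false = no-triangle (v , i , j , covered i u~i , covered j (sym same) , i~j)

  boundary-edge : {S : Subset n} {i j : Fin n} → Reach (EdgeRel G) i j → i ∉ S → j ∈ S →
                  Σ[ v ∈ Fin n ] Σ[ s ∈ Fin n ] v ∉ S × s ∈ S × Adj G v s ≡ true
  boundary-edge here        i∉S i∈S = contradiction i∈S i∉S
  boundary-edge {S} (step {j = k} i~k k⇝j) i∉S j∈S with k ∈? S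
  ... | yes k∈S = _ , k , i∉S , k∈S , i~k
  ... | no k∉S  = boundary-edge k⇝j k∉S j∈S

  data EarPath (S : Subset n) : Set where
    path₁ : {s₁ s₂ v : Fin n} → s₁ ∈ S → s₂ ∈ S → s₁ ≢ s₂ → v ∉ S →
            Adj G v s₁ ≡ true → Adj G v s₂ ≡ true → EarPath S
    path₂ : {s₁ s₂ v₁ v₂ : Fin n} → s₁ ∈ S → s₂ ∈ S → v₁ ∉ S → v₂ ∉ S →
            Adj G v₁ s₁ ≡ true → Adj G v₁ v₂ ≡ true → Adj G v₂ s₂ ≡ true → EarPath S

  -- Cross the boundary along an edge vs. If s is the only neighbour of v in S, then v and any other
  -- s′ ∈ S have a common neighbour c ≠ s, which lies outside S; so s v c s′ is an ear.
  ear-path : ConnectedGraph G → {S : Subset n} {s₀ s₁ o : Fin n} →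
             s₀ ∈ S → s₁ ∈ S → s₀ ≢ s₁ → o ∉ S → EarPath S
  ear-path conn {S} {s₀} {s₁} {o} s₀∈S s₁∈S s₀≢s₁ o∉S with boundary-edge (conn o s₀) o∉S s₀∈S
  ... | v , s , v∉S , s∈S , v~s with Fin.any? (λ a → (a ∈? S) ×-dec Adj? v a ×-dec ¬? (a Fin.≟ s))
  ...   | yes (a , a∈S , v~a , a≢s) = path₁ s∈S a∈S (a≢s ∘ sym) v∉S v~s v~a
  ...   | no unique with other-than-s
    where
    other-than-s : Σ[ s′ ∈ Fin n ] s′ ∈ S × s′ ≢ s
    other-than-s with s₀ Fin.≟ s
    ... | yes refl = s₁ , s₁∈S , s₀≢s₁ ∘ sym
    ... | no s₀≢s  = s₀ , s₀∈S , s₀≢s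
  ...     | s′ , s′∈S , s′≢s with common-neighbour (∈∉⇒≢ s′∈S v∉S) v≁s′ s
    where
    v≁s′ : Adj G v s′ ≡ false
    v≁s′ = Bool.¬-not λ v~s′ → unique (s′ , s′∈S , v~s′ , s′≢s)
  ...       | c , v~c , s′~c , c≢s = path₂ s∈S s′∈S v∉S c∉S v~s v~c (Adj-flip s′~c)
    where
    c∉S : c ∉ S
    c∉S c∈S = unique (c , c∈S , v~c , c≢s)

  module Growth (conn : ConnectedGraph G) {ρ : Fin n → ℕ} (balanced : Balanced ρ) (r : Fin n) where

    Grows : Subset n → Set
    Grows S = Σ[ S′ ∈ Subset n ] S ⊂ S′ × Solvable ρ S′ r

    grow-by-ear : {S : Subset n} {v : Fin n} {vs : List (Fin n)} → v ∉ S → Solvable ρ S r →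
                  (∀ f → Ear S (v ∷ vs) r f) → Grows S
    grow-by-ear {S} {v} {vs} v∉S solvable ear =
      S ∪ₗ (v ∷ vs) , (⊆-∪ₗ S (v ∷ vs) , v , All.head (∪ₗ-covers S (v ∷ vs)) , v∉S) ,
      extend {ρ = ρ} balanced solvable (λ f _ → ear f)

    grow : {S : Subset n} → EarPath S → Solvable ρ S r → Grows S
    grow (path₁ s₁∈S s₂∈S s₁≢s₂ v∉S v~s₁ v~s₂) solvable =
      grow-by-ear v∉S solvable (ear₁ s₁∈S s₂∈S s₁≢s₂ v∉S v~s₁ v~s₂)
    grow (path₂ s₁∈S s₂∈S v₁∉S v₂∉S v₁~s₁ v₁~v₂ v₂~s₂) solvable =
      grow-by-ear v₁∉S solvable (ear₂ s₁∈S s₂∈S v₁∉S v₂∉S v₁~s₁ v₁~v₂ v₂~s₂)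

    solvable-everywhere : {S : Subset n} {s₀ s₁ : Fin n} → Acc _⊃_ S → s₀ ∈ S → s₁ ∈ S → s₀ ≢ s₁ →
                          Solvable ρ S r → Σ[ S* ∈ Subset n ] (∀ v → v ∈ S*) × Solvable ρ S* r
    solvable-everywhere {S} (acc larger) s₀∈S s₁∈S s₀≢s₁ solvable with nonempty? (∁ S)
    ... | no none = S , (λ v → x∉∁p⇒x∈p λ v∈∁S → none (v , v∈∁S)) , solvable
    ... | yes (o , o∈∁S) with grow (ear-path conn s₀∈S s₁∈S s₀≢s₁ (x∈∁p⇒x∉p o∈∁S)) solvable
    ...   | S′ , S⊂S′ , solvable′ =
      solvable-everywhere (larger S⊂S′) (proj₁ S⊂S′ s₀∈S) (proj₁ S⊂S′ s₁∈S) s₀≢s₁ solvable′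

    connected-factors : {S : Subset n} {s₀ s₁ : Fin n} → s₀ ∈ S → s₁ ∈ S → s₀ ≢ s₁ → Solvable ρ S r →
                        ∀ f → sum (λ v → ρ v * toℕ (f v)) ≡₄ 0 → HasConnMod4Factor G f
    connected-factors s₀∈S s₁∈S s₀≢s₁ solvable f total
      with solvable-everywhere (⊃-wellFounded _) s₀∈S s₁∈S s₀≢s₁ solvable
    ... | S* , everywhere , solvable* =
      connected-factor everywhere (solvable* f (≡₄-trans (≡⇒≡₄ (charge-everywhere ρ f everywhere)) total))

module Theorem {n : ℕ} (G : SimpleGraph n) (3≤n : 3 ≤ n) (conn : ConnectedGraph G)
               (dense : ∀ v → n ≤ 2 * degree G v) where
  open Adjacency G
  open Extension G
  open Ears G
  open Dense G dense

  all-round-with-triangle : Triangle → AllRound G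
  all-round-with-triangle (a , b , c , a~b , a~c , b~c) f (divides q Σf≡q*2) =
    connected-factors (All.lookup T-covered (here refl)) (All.lookup T-covered (there (here refl))) (Adj⇒≢ a~b)
                      solvable-T f total
    where
    open Growth conn {ρ = λ _ → 2} (λ _ _ _ → mod4 refl) a
    T-list = a ∷ b ∷ c ∷ []
    T = ∅ ∪ₗ T-list
    T-covered = ∪ₗ-covers ∅ T-list
    even-on-T : ∀ f → charge (λ _ → 2) T f ≡₄ 0 → 2 * (toℕ (f a) + toℕ (f b) + toℕ (f c)) ≡₄ 0
    even-on-T f cond = ≡₄-trans (≡⇒≡₄ (begin
      2 * (toℕ (f a) + toℕ (f b) + toℕ (f c))
        ≡⟨ expand (toℕ (f a)) (toℕ (f b)) (toℕ (f c)) ⟩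
      0 + (2 * toℕ (f a) + (2 * toℕ (f b) + (2 * toℕ (f c) + 0)))
        ≡⟨ cong (_+ List.sum (map g T-list)) (sum-restrict-∅ g) ⟨
      sum (restrict ∅ g) + List.sum (map g T-list)
        ≡⟨ sum-restrict-∪ₗ g distinct (∉⊥ ∷ ∉⊥ ∷ ∉⊥ ∷ []) ⟨
      charge (λ _ → 2) T f ∎)) cond
      where
      open ≡-Reasoning
      g = λ v → 2 * toℕ (f v)
      distinct : Unique T-list
      distinct = (Adj⇒≢ a~b ∷ Adj⇒≢ a~c ∷ []) ∷ (Adj⇒≢ b~c ∷ []) ∷ [] ∷ []
      expand : ∀ x y z → 2 * (x + y + z) ≡ 0 + (2 * x + (2 * y + (2 * z + 0)))
      expand = solve-∀
    solvable-T : Solvable (λ _ → 2) T a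
    solvable-T = extend {ρ = λ _ → 2} (λ _ _ _ → mod4 refl) (∅-solvable (λ _ → 2) a)
                        (λ f cond → triangle-ear a~b a~c b~c f (even-on-T f cond))
    total : sum (λ v → 2 * toℕ (f v)) ≡₄ 0
    total = ≡₄-trans (≡⇒≡₄ (begin
      sum (λ v → 2 * toℕ (f v))       ≡⟨ *-distribˡ-sum 2 (toℕ ∘ f) ⟨
      2 * sum (toℕ ∘ f)               ≡⟨ cong (2 *_) (trans (sym (Σᵥ≡sum (toℕ ∘ f))) Σf≡q*2) ⟩
      2 * (q * 2)                     ≡⟨ regroup q ⟩
      0 + 4 * q                       ∎)) (+-4*-≡₄ 0 q)
      where
      open ≡-Reasoning
      regroup : ∀ q → 2 * (q * 2) ≡ 0 + 4 * q
      regroup = solve-∀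

  non-bipartite-all-round : ¬ Bipartite G → AllRound G
  non-bipartite-all-round non-bipartite with triangle?
  ... | yes triangle   = all-round-with-triangle triangle
  ... | no no-triangle = contradiction (triangle-free⇒bipartite 3≤n no-triangle) non-bipartite

  -- With charges 1 on one side and 3 on the other, start from a single vertex u, add a 4-cycle
  -- u v u′ v′ through it, and grow.
  bipartite-all-round : (c : Fin n → Bool) → IsBipartition G c → BipAllRound G c
  bipartite-all-round c proper f sides≡ = connected-factors u∈C v∈C (Adj⇒≢ u~v) solvable-C f total
    where
    ρ : Fin n → ℕ
    ρ w = if c w then 1 else 3
    balanced : Balanced ρ
    balanced x y x~y with c x in cx | c y in cy
    ... | true  | false = mod4 refl
    ... | false | true  = mod4 refl
    ... | true  | true  = contradiction (trans cx (sym cy)) (proper x y x~y)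
    ... | false | false = contradiction (trans cx (sym cy)) (proper x y x~y)
    u : Fin n
    u = fromℕ< (≤-trans (s≤s z≤n) 3≤n)
    open Growth conn {ρ = ρ} balanced u
    v = proj₁ (another-neighbour 3≤n u u)
    u~v = proj₁ (proj₂ (another-neighbour 3≤n u u))
    u′ = proj₁ (another-neighbour 3≤n v u)
    v~u′ = proj₁ (proj₂ (another-neighbour 3≤n v u))
    u′≢u = proj₂ (proj₂ (another-neighbour 3≤n v u))
    u≁u′ : Adj G u u′ ≡ false
    u≁u′ = Bool.¬-not λ u~u′ → proper u u′ u~u′
      (trans (Bool.¬-not (proper u v u~v)) (sym (Bool.¬-not (proper u′ v (Adj-flip v~u′)))))
    v′ = proj₁ (common-neighbour (u′≢u ∘ sym) u≁u′ v)
    u~v′ = proj₁ (proj₂ (common-neighbour (u′≢u ∘ sym) u≁u′ v))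
    u′~v′ = proj₁ (proj₂ (proj₂ (common-neighbour (u′≢u ∘ sym) u≁u′ v)))
    v′≢v = proj₂ (proj₂ (proj₂ (common-neighbour (u′≢u ∘ sym) u≁u′ v)))
    U = ∅ ∪ₗ (u ∷ [])
    C = U ∪ₗ (v ∷ u′ ∷ v′ ∷ [])
    u∈U = All.head (∪ₗ-covers ∅ (u ∷ []))
    u∈C = ⊆-∪ₗ U (v ∷ u′ ∷ v′ ∷ []) u∈U
    v∈C = All.head (∪ₗ-covers U (v ∷ u′ ∷ v′ ∷ []))
    ∉U : ∀ {x} → x ≢ u → x ∉ U
    ∉U x≢u = ∉-∪⁅⁆ ∉⊥ x≢u
    lone-vertex : ∀ f → charge ρ U f ≡₄ 0 → Ear ∅ (u ∷ []) u f
    lone-vertex f cond = record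
      { edges    = []
      ; attach   = []
      ; load≡f   = units-cancel (c u) (f u) (≡₄-trans (≡⇒≡₄ charge-U) cond) ∷ []
      ; anchored = (u , inj₂ refl , here) ∷ []
      }
      where
      g = λ w → ρ w * toℕ (f w)
      charge-U : ρ u * toℕ (f u) ≡ charge ρ U f
      charge-U = sym (trans (sum-restrict-∪ₗ g ([] ∷ []) (∉⊥ ∷ []))
                            (trans (cong (_+ (g u + 0)) (sum-restrict-∅ g)) (+-identityʳ (g u))))
    solvable-C : Solvable ρ C u
    solvable-C = extend {ρ = ρ} balanced (extend {ρ = ρ} balanced (∅-solvable ρ u) lone-vertex) λ f _ →
      ear₃ u∈U u∈U (∉U (Adj⇒≢ u~v ∘ sym)) (∉U u′≢u) (∉U (Adj⇒≢ u~v′ ∘ sym)) (v′≢v ∘ sym)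
           (Adj-flip u~v) v~u′ u′~v′ (Adj-flip u~v′) f
    pos neg : Fin n → ℕ
    pos w = if c w then toℕ (f w) else 0
    neg w = if c w then 0 else toℕ (f w)
    split : ∀ w → ρ w * toℕ (f w) ≡ pos w + 3 * neg w
    split w with c w
    ... | true  = refl
    ... | false = refl
    total : sum (λ w → ρ w * toℕ (f w)) ≡₄ 0
    total = begin
      sum (λ w → ρ w * toℕ (f w))          ≡⟨ sum-cong-≗ split ⟩
      sum (λ w → pos w + 3 * neg w)        ≡⟨ ∑-distrib-+ pos (λ w → 3 * neg w) ⟩
      sum pos + sum (λ w → 3 * neg w)      ≡⟨ cong (sum pos +_) (*-distribˡ-sum 3 neg) ⟨
      sum pos + 3 * sum neg                ≡⟨ cong₂ (λ p q → p + 3 * q) (Σᵥ≡sum pos) (Σᵥ≡sum neg) ⟨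
      Σᵥ pos + 3 * Σᵥ neg                  ≈⟨ +-cong-≡₄ (mod4 {Σᵥ pos} {Σᵥ neg} sides≡) ≡₄-refl ⟩
      Σᵥ neg + 3 * Σᵥ neg                  ≈⟨ +-4*-≡₄ 0 (Σᵥ neg) ⟩
      0                                    ∎
      where open ≡₄-Reasoning

proposition5p5 : (n : ℕ) (G : SimpleGraph n) → 3 ≤ n → ConnectedGraph G →
    (∀ v → n ≤ 2 * degree G v) →
    ((¬ Bipartite G → AllRound G) ×
     (∀ (c : Fin n → Bool) → IsBipartition G c → BipAllRound G c))
proposition5p5 n G 3≤n conn dense = non-bipartite-all-round , bipartite-all-round
  where open Theorem G 3≤n conn dense
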